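{- Let $0\le r\le n$. The function $\rho:S(n,r)\to\mathbb{N}_0$ satisfies: (i) $\rho(\hat 0)=0$, where $\hat0=0^\S\cdots0^\S\,|\,\bar1\,\bar2\cdots\overline{n-r}$ is the minimum of $S(n,r)$; (ii) if $w,w'\in S(n,r)$ and $w'$ covers $w$ with respect to $\sqsubseteq$, then $\rho(w')=\rho(w)+1$.
   Context: $A(n,r)$ is an alphabet of $n+1$ formal symbols $\tilde 1,\dots,\tilde r,\ 0^\S,\ \bar 1,\dots,\overline{n-r}$, totally ordered by $\overline{n-r}\prec\cdots\prec\bar1\prec 0^\S\prec\tilde1\prec\cdots\prec\tilde r$. $S(n,r)$ is the set of strings $w=i_1\cdots i_r\,|\,j_1\cdots j_{n-r}$ with $i_k\in\{\tilde1,\dots,\tilde r,0^\S\}$, $j_k\in\{0^\S,\bar1,\dots,\overline{n-r}\}$ such that for some $0\le p\le r$, $1\le q\le n-r+1$: $i_1\succ\cdots\succ i_p\succ 0^\S=i_{p+1}=\cdots=i_r$ and $j_1=\cdots=j_{q-1}=0^\S\succ j_q\succ\cdots\succ j_{n-r}$, ordered componentwise by $\preceq$ (order written $\sqsubseteq$). Identify symbols with nonnegative integers via $\tilde m\mapsto m$, $\bar m\mapsto m$, $0^\S\mapsto 0$, and for $w=i_1\cdots i_r|j_1\cdots j_{n-r}$ set $\rho(w)=i_1+\cdots+i_r+\sum_{k=1}^{n-r}(k-j_k)$. -}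

module Defs where

open import Data.Nat as ℕ using (ℕ; zero; suc; _∸_)
open import Data.Integer as ℤ using (ℤ; +_; -_; ∣_∣)
open import Data.Fin using (Fin; toℕ)
open import Data.Product using (Σ; _×_; _,_)
open import Relation.Binary.PropositionalEquality using (_≡_)
open import Relation.Nullary using (¬_)

-- Encoding of the alphabet A(n,r) into ℤ:
--   tilde m ↦ + m   (1 ≤ m ≤ r),   0^S ↦ 0,   bar m ↦ - (+ m)  (1 ≤ m ≤ n-r).
-- Under this encoding the total order ≼ on A(n,r) is exactly ℤ's ≤,
-- and the identification with nonnegative integers used in ρ is ∣_∣.

-- A word i₁⋯i_r | j₁⋯j_{n-r}, positions 0-based via Fin.
Word : ℕ → ℕ → Set
Word n r = (Fin r → ℤ) × (Fin (n ∸ r) → ℤ)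

InS : (n r : ℕ) → Word n r → Set
InS n r (i , j) =
  (∀ k → (+ 0 ℤ.≤ i k) × (i k ℤ.≤ + r)) ×
  (∀ k → (- (+ (n ∸ r)) ℤ.≤ j k) × (j k ℤ.≤ + 0)) ×
  (Σ ℕ λ p → (p ℕ.≤ r) ×
     (∀ k l → toℕ k ℕ.< toℕ l → toℕ l ℕ.< p → i l ℤ.< i k) ×
     (∀ k → toℕ k ℕ.< p → + 0 ℤ.< i k) ×
     (∀ k → p ℕ.≤ toℕ k → i k ≡ + 0)) ×
  -- j₁ = ⋯ = j_{q-1} = 0^S ≻ j_q ≻ ⋯ ≻ j_{n-r}  for some 1 ≤ q ≤ n-r+1
  -- (1-based position of k is toℕ k + 1)
  (Σ ℕ λ q → (1 ℕ.≤ q) × (q ℕ.≤ suc (n ∸ r)) ×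
     (∀ k → suc (toℕ k) ℕ.< q → j k ≡ + 0) ×
     (∀ k → q ℕ.≤ suc (toℕ k) → j k ℤ.< + 0) ×
     (∀ k l → q ℕ.≤ suc (toℕ k) → toℕ k ℕ.< toℕ l → j l ℤ.< j k))

_⊑_ : ∀ {n r} → Word n r → Word n r → Set
(i , j) ⊑ (i' , j') = (∀ k → i k ℤ.≤ i' k) × (∀ k → j k ℤ.≤ j' k)

_⊏_ : ∀ {n r} → Word n r → Word n r → Set
w ⊏ w' = (w ⊑ w') × ¬ (w' ⊑ w)

Covers : (n r : ℕ) → Word n r → Word n r → Set
Covers n r w' w = InS n r w × InS n r w' × (w ⊏ w') ×
  (∀ u → InS n r u → w ⊏ u → ¬ (u ⊏ w'))

sumFin : ∀ {m} → (Fin m → ℕ) → ℕ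
sumFin {zero}  f = 0
sumFin {suc m} f = f Fin.zero ℕ.+ sumFin (λ k → f (Fin.suc k))
  where import Data.Fin as Fin

-- ρ(w) = Σ_k i_k + Σ_{k=1}^{n-r} (k - j_k), with symbols read as nonnegative
-- integers via ∣_∣. For w ∈ S(n,r) each k - j_k is ≥ 0, so ∸ is exact there.
ρ : ∀ {n r} → Word n r → ℕ
ρ (i , j) = sumFin (λ k → ∣ i k ∣) ℕ.+ sumFin (λ k → suc (toℕ k) ∸ ∣ j k ∣)

zeroHat : (n r : ℕ) → Word n r
zeroHat n r = (λ _ → + 0) , (λ k → - (+ suc (toℕ k)))

-- If w' covers w, raise by one the first letter where w' exceeds w. Each half
-- of a word of S(n,r) is strictly decreasing except along a run of 0^S
-- (Descending), and the raise preserves this, so the raised word lies in S,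
-- strictly above w and below w', hence equals w'. Raising a letter adds one to
-- ρ; on the right this uses that a negative letter in position k is at least
-- -k, so the truncated k ∸ ∣j_k∣ is exact.
module Submission where

open import Defs
open import Data.Nat as ℕ using (ℕ; _≤_; suc; zero; z≤n; s≤s; _∸_; _+_)
import Data.Nat.Properties as ℕ
open import Data.Integer as ℤ using (ℤ; +_; -[1+_]; ∣_∣; -_; 0ℤ) renaming (suc to sucℤ)
import Data.Integer.Properties as ℤ
open import Data.Fin as Fin using (Fin; toℕ; fromℕ<)
import Data.Fin.Properties as Fin
open import Data.Vec.Functional using (updateAt)
open import Data.Vec.Functional.Properties using (updateAt-updates; updateAt-minimal)
open import Data.Vec.Functional.Relation.Binary.Pointwise using (Pointwise)
open import Data.Product using (Σ; ∃; _×_; _,_; proj₁; proj₂)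
open import Data.Sum using (_⊎_; inj₁; inj₂)
open import Function using (_∘_)
open import Relation.Nullary using (¬_; Dec; yes; no; contradiction)
open import Relation.Nullary.Decidable using (decidable-stable; _×-dec_)
open import Relation.Unary using (Pred; Decidable)
open import Relation.Binary.PropositionalEquality
  using (_≡_; _≢_; ≢-sym; refl; sym; trans; cong; cong₂; subst)

private
  variable
    m : ℕ

sumFin-cong : {f g : Fin m → ℕ} → (∀ k → f k ≡ g k) → sumFin f ≡ sumFin g
sumFin-cong {zero}  f≡g = refl
sumFin-cong {suc m} f≡g = cong₂ _+_ (f≡g Fin.zero) (sumFin-cong (f≡g ∘ Fin.suc))

sumFin-zero : {f : Fin m → ℕ} → (∀ k → f k ≡ 0) → sumFin f ≡ 0
sumFin-zero {zero}  f≡0 = refl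
sumFin-zero {suc m} f≡0 = cong₂ _+_ (f≡0 Fin.zero) (sumFin-zero (f≡0 ∘ Fin.suc))

sumFin-suc-at : {f g : Fin m → ℕ} (k : Fin m) → g k ≡ suc (f k) →
                (∀ l → l ≢ k → g l ≡ f l) → sumFin g ≡ suc (sumFin f)
sumFin-suc-at {suc m} Fin.zero    gk others =
  cong₂ _+_ gk (sumFin-cong (λ l → others (Fin.suc l) (λ ())))
sumFin-suc-at {suc m} {f} (Fin.suc k) gk others =
  trans (cong₂ _+_ (others Fin.zero (λ ()))
                   (sumFin-suc-at k gk (λ l l≢k → others (Fin.suc l) (l≢k ∘ Fin.suc-injective))))
        (ℕ.+-suc (f Fin.zero) _)

smallest-counterexample : ∀ {p} (P : Pred (Fin m) p) → Decidable P → ¬ (∀ k → P k) →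
                          ∃ λ k → ¬ P k × (∀ l → toℕ l ℕ.< toℕ k → P l)
smallest-counterexample {m} P P? ¬∀P with Fin.¬∀⟶∃¬-smallest m P P? ¬∀P
... | k , ¬Pk , P-below = k , ¬Pk , λ l l<k →
  subst P (Fin.toℕ-injective (trans (Fin.toℕ-inject (fromℕ< l<k)) (Fin.toℕ-fromℕ< l<k)))
        (P-below (fromℕ< l<k))

Descending : (Fin m → ℤ) → Set
Descending f = ∀ {k l} → toℕ k ℕ.< toℕ l → f l ℤ.< f k ⊎ (f k ≡ 0ℤ × f l ≡ 0ℤ)

descending-strict : {f : Fin m → ℤ} → Descending f →
                    ∀ {k l} → toℕ k ℕ.< toℕ l → f k ≢ 0ℤ → f l ℤ.< f k
descending-strict desc k<l fk≢0 with desc k<l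
... | inj₁ fl<fk       = fl<fk
... | inj₂ (fk≡0 , _) = contradiction fk≡0 fk≢0

descending-tail : {f : Fin (suc m) → ℤ} → Descending f → Descending (f ∘ Fin.suc)
descending-tail desc k<l = desc (s≤s k<l)

LeftShape : (Fin m → ℤ) → Set
LeftShape {m} f = Σ ℕ λ p → (p ℕ.≤ m) ×
  (∀ k l → toℕ k ℕ.< toℕ l → toℕ l ℕ.< p → f l ℤ.< f k) ×
  (∀ k → toℕ k ℕ.< p → + 0 ℤ.< f k) ×
  (∀ k → p ℕ.≤ toℕ k → f k ≡ + 0)

RightShape : (Fin m → ℤ) → Set
RightShape {m} f = Σ ℕ λ q → (1 ℕ.≤ q) × (q ℕ.≤ suc m) ×
  (∀ k → suc (toℕ k) ℕ.< q → f k ≡ + 0) ×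
  (∀ k → q ℕ.≤ suc (toℕ k) → f k ℤ.< + 0) ×
  (∀ k l → q ℕ.≤ suc (toℕ k) → toℕ k ℕ.< toℕ l → f l ℤ.< f k)

leftShape⇒descending : {f : Fin m → ℤ} → LeftShape f → Descending f
leftShape⇒descending (p , _ , strict , pos , zero-from) {k} {l} k<l
  with toℕ l ℕ.<? p | toℕ k ℕ.<? p
... | yes l<p | _     = inj₁ (strict k l k<l l<p)
... | no l≮p  | yes k<p rewrite zero-from l (ℕ.≮⇒≥ l≮p) = inj₁ (pos k k<p)
... | no l≮p  | no k≮p = inj₂ (zero-from k (ℕ.≮⇒≥ k≮p) , zero-from l (ℕ.≮⇒≥ l≮p))

rightShape⇒descending : {f : Fin m → ℤ} → RightShape f → Descending f
rightShape⇒descending (q , _ , _ , zero-before , neg , strict) {k} {l} k<l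
  with q ℕ.≤? suc (toℕ k) | q ℕ.≤? suc (toℕ l)
... | yes q≤k | _     = inj₁ (strict k l q≤k k<l)
... | no q≰k  | yes q≤l rewrite zero-before k (ℕ.≰⇒> q≰k) = inj₁ (neg l q≤l)
... | no q≰k  | no q≰l = inj₂ (zero-before k (ℕ.≰⇒> q≰k) , zero-before l (ℕ.≰⇒> q≰l))

descending⇒leftShape : {f : Fin m → ℤ} → (∀ k → + 0 ℤ.≤ f k) → Descending f → LeftShape f
descending⇒leftShape {m} {f} nonneg desc with Fin.all? (λ k → + 0 ℤ.<? f k)
... | yes all-pos =
  m , ℕ.≤-refl ,
  (λ k l k<l _ → descending-strict desc k<l (≢-sym (ℤ.<⇒≢ (all-pos k)))) ,
  (λ k _ → all-pos k) ,
  (λ k m≤k → contradiction (Fin.toℕ<n k) (ℕ.≤⇒≯ m≤k))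
... | no ¬all-pos with smallest-counterexample (λ k → + 0 ℤ.< f k) (λ k → + 0 ℤ.<? f k) ¬all-pos
...   | k₀ , fk₀≯0 , pos-below =
  toℕ k₀ , ℕ.<⇒≤ (Fin.toℕ<n k₀) ,
  (λ k l k<l l<k₀ → descending-strict desc k<l (≢-sym (ℤ.<⇒≢ (pos-below k (ℕ.<-trans k<l l<k₀))))) ,
  pos-below ,
  zero-from
  where
  fk₀≡0 : f k₀ ≡ 0ℤ
  fk₀≡0 = ℤ.≤-antisym (ℤ.≮⇒≥ fk₀≯0) (nonneg k₀)

  zero-from : ∀ l → toℕ k₀ ℕ.≤ toℕ l → f l ≡ + 0
  zero-from l k₀≤l with ℕ.m≤n⇒m<n∨m≡n k₀≤l
  ... | inj₂ k₀≡l = subst (λ x → f x ≡ + 0) (Fin.toℕ-injective k₀≡l) fk₀≡0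
  ... | inj₁ k₀<l with desc k₀<l
  ...   | inj₁ fl<fk₀ = contradiction (subst (f l ℤ.<_) fk₀≡0 fl<fk₀) (ℤ.≤⇒≯ (nonneg l))
  ...   | inj₂ (_ , fl≡0) = fl≡0

descending⇒rightShape : {f : Fin m → ℤ} → (∀ k → f k ℤ.≤ + 0) → Descending f → RightShape f
descending⇒rightShape {m} {f} nonpos desc with Fin.all? (λ k → + 0 ℤ.≤? f k)
... | yes all-nonneg =
  suc m , s≤s z≤n , ℕ.≤-refl ,
  (λ k _ → ℤ.≤-antisym (nonpos k) (all-nonneg k)) ,
  (λ k m<k → contradiction (Fin.toℕ<n k) (ℕ.≤⇒≯ (ℕ.s≤s⁻¹ m<k))) ,
  (λ k _ m<k → contradiction (Fin.toℕ<n k) (ℕ.≤⇒≯ (ℕ.s≤s⁻¹ m<k)))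
... | no ¬all-nonneg with smallest-counterexample (λ k → + 0 ℤ.≤ f k) (λ k → + 0 ℤ.≤? f k) ¬all-nonneg
...   | k₀ , fk₀≱0 , nonneg-below =
  suc (toℕ k₀) , s≤s z≤n , s≤s (ℕ.<⇒≤ (Fin.toℕ<n k₀)) ,
  (λ k k<k₀ → ℤ.≤-antisym (nonpos k) (nonneg-below k (ℕ.s≤s⁻¹ k<k₀))) ,
  neg-from ,
  (λ k l k₀≤k k<l → descending-strict desc k<l (ℤ.<⇒≢ (neg-from k k₀≤k)))
  where
  neg-from : ∀ l → suc (toℕ k₀) ℕ.≤ suc (toℕ l) → f l ℤ.< + 0
  neg-from l k₀≤l with ℕ.m≤n⇒m<n∨m≡n (ℕ.s≤s⁻¹ k₀≤l)
  ... | inj₂ k₀≡l = subst (λ x → f x ℤ.< + 0) (Fin.toℕ-injective k₀≡l) (ℤ.≰⇒> fk₀≱0)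
  ... | inj₁ k₀<l =
    ℤ.<-trans (descending-strict desc k₀<l (ℤ.<⇒≢ (ℤ.≰⇒> fk₀≱0))) (ℤ.≰⇒> fk₀≱0)

bump : (Fin m → ℤ) → Fin m → Fin m → ℤ
bump f k = updateAt f k sucℤ

bump-cases : (f : Fin m → ℤ) (k l : Fin m) →
             (l ≡ k × bump f k l ≡ sucℤ (f l)) ⊎ (l ≢ k × bump f k l ≡ f l)
bump-cases f k l with l Fin.≟ k
... | yes refl = inj₁ (refl , updateAt-updates k f)
... | no l≢k   = inj₂ (l≢k , updateAt-minimal l k f l≢k)

≤-bump : (f : Fin m → ℤ) (k : Fin m) → Pointwise ℤ._≤_ f (bump f k)
≤-bump f k l with bump-cases f k l
... | inj₁ (_ , e) rewrite e = ℤ.i≤suc[i] (f l)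
... | inj₂ (_ , e) rewrite e = ℤ.≤-refl

bump≰ : (f : Fin m → ℤ) (k : Fin m) → ¬ Pointwise ℤ._≤_ (bump f k) f
bump≰ f k bump≤f = ℤ.<-irrefl refl
  (ℤ.suc[i]≤j⇒i<j (subst (ℤ._≤ f k) (updateAt-updates k f) (bump≤f k)))

bump-≤ : {f g : Fin m → ℤ} {k : Fin m} → Pointwise ℤ._≤_ f g → f k ℤ.< g k →
         Pointwise ℤ._≤_ (bump f k) g
bump-≤ {f = f} {k = k} f≤g fk<gk l with bump-cases f k l
... | inj₁ (refl , e) rewrite e = ℤ.i<j⇒suc[i]≤j fk<gk
... | inj₂ (_ , e)    rewrite e = f≤g l

-- Before k the two agree, so g bounds the raised letter from the left.
bump-descending : {f g : Fin m → ℤ} {k : Fin m} → Descending f → Descending g →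
                  f k ℤ.< g k → (∀ l → toℕ l ℕ.< toℕ k → f l ≡ g l) →
                  Descending (bump f k)
bump-descending {f = f} {g} {k} desc-f desc-g fk<gk agree {a} {b} a<b
  with bump-cases f k a | bump-cases f k b
... | inj₁ (refl , _) | inj₁ (refl , _) = contradiction a<b (ℕ.<-irrefl refl)
... | inj₁ (refl , ea) | inj₂ (_ , eb) rewrite ea | eb with desc-f a<b
...   | inj₁ fb<fa = inj₁ (ℤ.<-trans fb<fa (ℤ.suc[i]≤j⇒i<j ℤ.≤-refl))
...   | inj₂ (fa≡0 , fb≡0) rewrite fa≡0 | fb≡0 = inj₁ (ℤ.+<+ (s≤s z≤n))
bump-descending {f = f} {g} {k} desc-f desc-g fk<gk agree {a} {b} a<b
    | inj₂ (_ , ea) | inj₁ (refl , eb) rewrite ea | eb | agree a a<b with desc-g a<b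
...   | inj₁ gb<ga = inj₁ (ℤ.≤-<-trans (ℤ.i<j⇒suc[i]≤j fk<gk) gb<ga)
...   | inj₂ (ga≡0 , gb≡0) with sucℤ (f b) ℤ.≟ 0ℤ
...     | yes fb+1≡0 = inj₂ (ga≡0 , fb+1≡0)
...     | no fb+1≢0  = inj₁ (subst (sucℤ (f b) ℤ.<_) (sym ga≡0)
                               (ℤ.≤∧≢⇒< (subst (sucℤ (f b) ℤ.≤_) gb≡0 (ℤ.i<j⇒suc[i]≤j fk<gk)) fb+1≢0))
bump-descending {f = f} {g} {k} desc-f desc-g fk<gk agree {a} {b} a<b
    | inj₂ (_ , ea) | inj₂ (_ , eb) rewrite ea | eb = desc-f a<b

∣∣≤-of-bounds : ∀ {B x} → - (+ B) ℤ.≤ x → x ℤ.< 0ℤ → ∣ x ∣ ℕ.≤ B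
∣∣≤-of-bounds {zero}  { -[1+ a ]} () _
∣∣≤-of-bounds {suc B} { -[1+ a ]} (ℤ.-≤- a≤B) _ = s≤s a≤B
∣∣≤-of-bounds {x = + a} _ (ℤ.+<+ ())

∣∣-antitone-neg : ∀ {x y} → x ℤ.< y → y ℤ.< 0ℤ → ∣ y ∣ ℕ.< ∣ x ∣
∣∣-antitone-neg (ℤ.-<- b<a) _           = s≤s b<a
∣∣-antitone-neg _           (ℤ.+<+ ())

descending-neg-bound : ∀ {B} {f : Fin m → ℤ} → Descending f → (∀ l → - (+ B) ℤ.≤ f l) →
                       ∀ k → f k ℤ.< 0ℤ → ∣ f k ∣ + (m ∸ suc (toℕ k)) ℕ.≤ B
descending-neg-bound {suc m} desc bounded (Fin.suc k) fk<0 =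
  descending-neg-bound (descending-tail desc) (bounded ∘ Fin.suc) k fk<0
descending-neg-bound {suc zero} {f = f} desc bounded Fin.zero f0<0 =
  subst (ℕ._≤ _) (sym (ℕ.+-identityʳ ∣ f Fin.zero ∣)) (∣∣≤-of-bounds (bounded Fin.zero) f0<0)
descending-neg-bound {suc (suc m)} {B} {f} desc bounded Fin.zero f0<0 = begin
  ∣ f Fin.zero ∣ + suc m        ≡⟨ ℕ.+-suc ∣ f Fin.zero ∣ m ⟩
  suc (∣ f Fin.zero ∣) + m      ≤⟨ ℕ.+-monoˡ-≤ m (∣∣-antitone-neg f1<f0 f0<0) ⟩
  (∣ f (Fin.suc Fin.zero) ∣) + m ≤⟨ descending-neg-bound (descending-tail desc) (bounded ∘ Fin.suc)
                                     Fin.zero (ℤ.<-trans f1<f0 f0<0) ⟩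
  B                             ∎
  where
  open ℕ.≤-Reasoning
  f1<f0 : f (Fin.suc Fin.zero) ℤ.< f Fin.zero
  f1<f0 = descending-strict desc (s≤s z≤n) (ℤ.<⇒≢ f0<0)

descending-neg-∣∣≤ : {f : Fin m → ℤ} → Descending f → (∀ l → - (+ m) ℤ.≤ f l) →
                     ∀ k → f k ℤ.< 0ℤ → ∣ f k ∣ ℕ.≤ suc (toℕ k)
descending-neg-∣∣≤ {m} {f} desc bounded k fk<0 = ℕ.+-cancelʳ-≤ room ∣ f k ∣ (suc (toℕ k))
  (subst (∣ f k ∣ + room ℕ.≤_) (trans (sym (ℕ.m∸n+n≡m (Fin.toℕ<n k))) (ℕ.+-comm room _))
         (descending-neg-bound desc bounded k fk<0))
  where room = m ∸ suc (toℕ k)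

∣suc∣-nonneg : ∀ {x} → + 0 ℤ.≤ x → ∣ sucℤ x ∣ ≡ suc ∣ x ∣
∣suc∣-nonneg {+ a} _ = refl

∸-∣suc∣-neg : ∀ n {x} → x ℤ.< 0ℤ → ∣ x ∣ ℕ.≤ n → n ∸ ∣ sucℤ x ∣ ≡ suc (n ∸ ∣ x ∣)
∸-∣suc∣-neg (suc n) { -[1+ zero ]}  _ _               = refl
∸-∣suc∣-neg (suc n) { -[1+ suc a ]} _ (s≤s 1+a≤n) = ℕ.+-∸-assoc 1 1+a≤n
∸-∣suc∣-neg n       {+ a}          (ℤ.+<+ ()) _

ρ-bumpˡ : ∀ n {r} (i : Fin r → ℤ) (j : Fin (n ∸ r) → ℤ) k → + 0 ℤ.≤ i k →
          ρ {n} (bump i k , j) ≡ suc (ρ {n} (i , j))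
ρ-bumpˡ n i j k 0≤ik = cong (_+ sumFin (λ l → suc (toℕ l) ∸ ∣ j l ∣))
  (sumFin-suc-at k (trans (cong ∣_∣ (updateAt-updates k i)) (∣suc∣-nonneg 0≤ik))
                   (λ l l≢k → cong ∣_∣ (updateAt-minimal l k i l≢k)))

ρ-bumpʳ : ∀ n {r} (i : Fin r → ℤ) (j : Fin (n ∸ r) → ℤ) k →
          j k ℤ.< 0ℤ → ∣ j k ∣ ℕ.≤ suc (toℕ k) →
          ρ {n} (i , bump j k) ≡ suc (ρ {n} (i , j))
ρ-bumpʳ n i j k jk<0 ∣jk∣≤k+1 = trans
  (cong (λ s → sumFin (λ l → ∣ i l ∣) + s)
    (sumFin-suc-at k
      (trans (cong (λ x → suc (toℕ k) ∸ ∣ x ∣) (updateAt-updates k j))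
             (∸-∣suc∣-neg (suc (toℕ k)) jk<0 ∣jk∣≤k+1))
      (λ l l≢k → cong (λ x → suc (toℕ l) ∸ ∣ x ∣) (updateAt-minimal l k j l≢k))))
  (ℕ.+-suc _ _)

ρ-zeroHat : ∀ n r → ρ (zeroHat n r) ≡ 0
ρ-zeroHat n r = cong₂ _+_ (sumFin-zero {r} (λ _ → refl))
                          (sumFin-zero {n ∸ r} (λ k → ℕ.n∸n≡0 (suc (toℕ k))))

first-increase : {f g : Fin m → ℤ} → Pointwise ℤ._≤_ f g → ¬ Pointwise ℤ._≤_ g f →
                 ∃ λ k → f k ℤ.< g k × (∀ l → toℕ l ℕ.< toℕ k → f l ≡ g l)
first-increase {f = f} {g} f≤g g≰f
  with smallest-counterexample (λ l → g l ℤ.≤ f l) (λ l → g l ℤ.≤? f l) g≰f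
... | k , gk≰fk , g≤f-below =
  k , ℤ.≰⇒> gk≰fk , λ l l<k → ℤ.≤-antisym (f≤g l) (g≤f-below l l<k)

Within : ℤ → ℤ → (Fin m → ℤ) → Set
Within lo hi f = ∀ l → (lo ℤ.≤ f l) × (f l ℤ.≤ hi)

bump-within : ∀ {lo hi} {f g : Fin m → ℤ} {k} → Within lo hi f → Within lo hi g →
              Pointwise ℤ._≤_ f g → f k ℤ.< g k → Within lo hi (bump f k)
bump-within {f = f} {k = k} f-within g-within f≤g fk<gk l =
  ℤ.≤-trans (proj₁ (f-within l)) (≤-bump f k l) ,
  ℤ.≤-trans (bump-≤ f≤g fk<gk l) (proj₂ (g-within l))

bump-leftShape : {f g : Fin m → ℤ} {k : Fin m} → Within 0ℤ (+ m) f →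
                 LeftShape f → LeftShape g → f k ℤ.< g k →
                 (∀ l → toℕ l ℕ.< toℕ k → f l ≡ g l) → LeftShape (bump f k)
bump-leftShape {f = f} {k = k} f-within f-shape g-shape fk<gk agree =
  descending⇒leftShape (λ l → ℤ.≤-trans (proj₁ (f-within l)) (≤-bump f k l))
    (bump-descending (leftShape⇒descending f-shape) (leftShape⇒descending g-shape) fk<gk agree)

bump-rightShape : {f g : Fin m → ℤ} {k : Fin m} → Within (- (+ m)) 0ℤ g →
                  Pointwise ℤ._≤_ f g → RightShape f → RightShape g → f k ℤ.< g k →
                  (∀ l → toℕ l ℕ.< toℕ k → f l ≡ g l) → RightShape (bump f k)
bump-rightShape g-within f≤g f-shape g-shape fk<gk agree =
  descending⇒rightShape (λ l → ℤ.≤-trans (bump-≤ f≤g fk<gk l) (proj₂ (g-within l)))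
    (bump-descending (rightShape⇒descending f-shape) (rightShape⇒descending g-shape) fk<gk agree)

_⊑?_ : ∀ {n r} (w w' : Word n r) → Dec (w ⊑ w')
(i , j) ⊑? (i' , j') = Fin.all? (λ k → i k ℤ.≤? i' k) ×-dec Fin.all? (λ k → j k ℤ.≤? j' k)

ρ-cong : ∀ {n r} {w u : Word n r} → w ⊑ u → u ⊑ w → ρ w ≡ ρ u
ρ-cong (i≤i' , j≤j') (i'≤i , j'≤j) = cong₂ _+_
  (sumFin-cong (λ l → cong ∣_∣ (ℤ.≤-antisym (i≤i' l) (i'≤i l))))
  (sumFin-cong (λ l → cong (λ x → suc (toℕ l) ∸ ∣ x ∣) (ℤ.≤-antisym (j≤j' l) (j'≤j l))))

ρ-covered : ∀ {n r} {w w' u : Word n r} → Covers n r w' w →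
            InS n r u → w ⊏ u → u ⊑ w' → ρ w' ≡ ρ u
ρ-covered {w' = w'} {u} (_ , _ , _ , nothing-between) u∈S w⊏u u⊑w' =
  ρ-cong (decidable-stable (w' ⊑? u) (λ w'⋢u → nothing-between u u∈S w⊏u (u⊑w' , w'⋢u))) u⊑w'

ρ-covers : ∀ n r (w w' : Word n r) → Covers n r w' w → ρ w' ≡ suc (ρ w)
ρ-covers n r (i , j) (i' , j')
  cov@((i-within , j-within , i-shape , j-shape) , (i'-within , j'-within , i'-shape , j'-shape) ,
       ((i≤i' , j≤j') , w'⋢w) , _)
  with Fin.all? (λ l → i' l ℤ.≤? i l)
... | no i'≰i with first-increase i≤i' i'≰i
...   | k , ik<i'k , agree = trans
  (ρ-covered cov
     (bump-within i-within i'-within i≤i' ik<i'k , j-within ,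
      bump-leftShape i-within i-shape i'-shape ik<i'k agree , j-shape)
     ((≤-bump i k , λ _ → ℤ.≤-refl) , bump≰ i k ∘ proj₁)
     (bump-≤ i≤i' ik<i'k , j≤j'))
  (ρ-bumpˡ n i j k (proj₁ (i-within k)))
ρ-covers n r (i , j) (i' , j')
  cov@((i-within , j-within , i-shape , j-shape) , (i'-within , j'-within , i'-shape , j'-shape) ,
       ((i≤i' , j≤j') , w'⋢w) , _)
  | yes i'≤i with first-increase j≤j' (λ j'≤j → w'⋢w (i'≤i , j'≤j))
...   | k , jk<j'k , agree = trans
  (ρ-covered cov
     (i-within , bump-within j-within j'-within j≤j' jk<j'k ,
      i-shape , bump-rightShape j'-within j≤j' j-shape j'-shape jk<j'k agree)
     (((λ _ → ℤ.≤-refl) , ≤-bump j k) , bump≰ j k ∘ proj₂)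
     (i≤i' , bump-≤ j≤j' jk<j'k))
  (ρ-bumpʳ n i j k jk<0
     (descending-neg-∣∣≤ (rightShape⇒descending j-shape) (proj₁ ∘ j-within) k jk<0))
  where
  jk<0 : j k ℤ.< 0ℤ
  jk<0 = ℤ.<-≤-trans jk<j'k (proj₂ (j'-within k))

mainTheorem5 : (n r : ℕ) → r ≤ n →
    (ρ (zeroHat n r) ≡ 0) ×
    (∀ w w' → Covers n r w' w → ρ w' ≡ suc (ρ w))
mainTheorem5 n r _ = ρ-zeroHat n r , ρ-covers n r
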